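{- Let $q\in\{2,3,4\}$. Then: (i) the double circulant $[n,n/2]$ code $\mathcal{C}((0,0,\dots,0))$ over $\mathbb{F}_q$ has minimum weight $1$ for all positive even integers $n$; (ii) the double circulant $[n,n/2]$ code $\mathcal{C}((1,0,0,\dots,0))$ over $\mathbb{F}_q$ has minimum weight $2$ for all positive even integers $n$; (iii) the double circulant $[n,n/2]$ code $\mathcal{C}((1,1,0,0,\dots,0))$ over $\mathbb{F}_q$ has minimum weight $3$ for all even integers $n\ge 6$; the ternary double negacirculant $[4,2]$ code $\mathcal{N}((1,1))$ has minimum weight $3$; the quaternary double circulant $[4,2]$ code $\mathcal{C}((1,\omega))$ has minimum weight $3$; (iv) the double circulant $[n,n/2]$ code $\mathcal{C}((0,1,1,\dots,1))$ over $\mathbb{F}_q$ has minimum weight $4$ for all even integers $n\ge 8$; the quaternary double circulant $[6,3]$ code $\mathcal{C}((1,\omega,1))$ has minimum weight $4$.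
   Context: For $r=(r_0,\dots,r_{m-1})\in\mathbb{F}_q^m$ and $\mu\in\{1,-1\}$, let $A_\mu(r)$ be the $m\times m$ matrix with $(i,j)$ entry ($0\le i,j\le m-1$) equal to $r_{j-i}$ if $j\ge i$ and $\mu r_{m+j-i}$ if $j<i$. The double circulant code $\mathcal{C}(r)$ (resp. double negacirculant code $\mathcal{N}(r)$) is the $[2m,m]$ code with generator matrix $(I_m\mid A_1(r))$ (resp. $(I_m\mid A_{ -1}(r))$); so an $[n,n/2]$ such code has $r$ of length $n/2$. $\mathbb{F}_2=\{0,1\}$, $\mathbb{F}_3=\{0,1,2\}$, $\mathbb{F}_4=\{0,1,\omega,\omega^2\}$ with $\omega^2=\omega+1$. Minimum weight means smallest Hamming weight of a nonzero codeword. -}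

module Defs where

open import Data.Nat using (ℕ; zero; suc; _∸_) renaming (_+_ to _+ℕ_)
open import Data.Nat using (_≤_; _<_; _≤?_; z≤n; s≤s)
open import Data.Nat.Properties using (m∸n≤m; ≤-<-trans; ∸-monoˡ-<; m+n∸n≡m; +-monoʳ-<; ≤-trans; m≤m+n; <⇒≤; ≰⇒>)
open import Data.Fin using (Fin; toℕ; fromℕ<; splitAt)
import Data.Fin as Fin
open import Data.Fin.Properties using (toℕ<n)
open import Data.Vec using (Vec; lookup)
open import Data.Sum using (inj₁; inj₂)
open import Data.Product using (Σ; _×_; _,_)
open import Relation.Binary.Definitions using (DecidableEquality)
open import Relation.Binary.PropositionalEquality using (_≡_; _≢_; refl; subst)
open import Relation.Nullary using (yes; no; ¬_)

record FieldOps : Set₁ where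
  infixl 6 _+_
  infixl 7 _*_
  field
    Carrier : Set
    0# 1#   : Carrier
    _+_ _*_ : Carrier → Carrier → Carrier
    -_      : Carrier → Carrier
    _≟_     : DecidableEquality Carrier

data F2 : Set where
  o2 i2 : F2

add2 mul2 : F2 → F2 → F2
add2 o2 y = y
add2 i2 o2 = i2
add2 i2 i2 = o2
mul2 o2 y = o2
mul2 i2 y = y

dec2 : DecidableEquality F2
dec2 o2 o2 = yes refl
dec2 o2 i2 = no λ ()
dec2 i2 o2 = no λ ()
dec2 i2 i2 = yes refl

GF2 : FieldOps
GF2 = record { Carrier = F2 ; 0# = o2 ; 1# = i2 ; _+_ = add2 ; _*_ = mul2
             ; -_ = λ x → x ; _≟_ = dec2 }

data F3 : Set where
  o3 i3 t3 : F3

add3 mul3 : F3 → F3 → F3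
add3 o3 y = y
add3 i3 o3 = i3
add3 i3 i3 = t3
add3 i3 t3 = o3
add3 t3 o3 = t3
add3 t3 i3 = o3
add3 t3 t3 = i3
mul3 o3 y = o3
mul3 i3 y = y
mul3 t3 o3 = o3
mul3 t3 i3 = t3
mul3 t3 t3 = i3

neg3 : F3 → F3
neg3 o3 = o3
neg3 i3 = t3
neg3 t3 = i3

dec3 : DecidableEquality F3
dec3 o3 o3 = yes refl
dec3 o3 i3 = no λ ()
dec3 o3 t3 = no λ ()
dec3 i3 o3 = no λ ()
dec3 i3 i3 = yes refl
dec3 i3 t3 = no λ ()
dec3 t3 o3 = no λ ()
dec3 t3 i3 = no λ ()
dec3 t3 t3 = yes refl

GF3 : FieldOps
GF3 = record { Carrier = F3 ; 0# = o3 ; 1# = i3 ; _+_ = add3 ; _*_ = mul3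
             ; -_ = neg3 ; _≟_ = dec3 }

-- F_4 = {0,1,ω,ω²} with ω² = ω + 1
data F4 : Set where
  o4 i4 ω ω² : F4

add4 mul4 : F4 → F4 → F4
add4 o4 y = y
add4 i4 o4 = i4
add4 i4 i4 = o4
add4 i4 ω = ω²
add4 i4 ω² = ω
add4 ω o4 = ω
add4 ω i4 = ω²
add4 ω ω = o4
add4 ω ω² = i4
add4 ω² o4 = ω²
add4 ω² i4 = ω
add4 ω² ω = i4
add4 ω² ω² = o4
mul4 o4 y = o4
mul4 i4 y = y
mul4 ω o4 = o4
mul4 ω i4 = ω
mul4 ω ω = ω²
mul4 ω ω² = i4
mul4 ω² o4 = o4
mul4 ω² i4 = ω²
mul4 ω² ω = i4
mul4 ω² ω² = ω

dec4 : DecidableEquality F4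
dec4 o4 o4 = yes refl
dec4 o4 i4 = no λ ()
dec4 o4 ω = no λ ()
dec4 o4 ω² = no λ ()
dec4 i4 o4 = no λ ()
dec4 i4 i4 = yes refl
dec4 i4 ω = no λ ()
dec4 i4 ω² = no λ ()
dec4 ω o4 = no λ ()
dec4 ω i4 = no λ ()
dec4 ω ω = yes refl
dec4 ω ω² = no λ ()
dec4 ω² o4 = no λ ()
dec4 ω² i4 = no λ ()
dec4 ω² ω = no λ ()
dec4 ω² ω² = yes refl

GF4 : FieldOps
GF4 = record { Carrier = F4 ; 0# = o4 ; 1# = i4 ; _+_ = add4 ; _*_ = mul4
             ; -_ = λ x → x ; _≟_ = dec4 }

data Q : Set where
  q2 q3 q4 : Q

𝔽 : Q → FieldOps
𝔽 q2 = GF2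
𝔽 q3 = GF3
𝔽 q4 = GF4

module _ (F : FieldOps) where
  open FieldOps F

  Σᶠ : (m : ℕ) → (Fin m → Carrier) → Carrier
  Σᶠ zero f = 0#
  Σᶠ (suc m) f = f Fin.zero + Σᶠ m (λ i → f (Fin.suc i))

  weight : {n : ℕ} → (Fin n → Carrier) → ℕ
  weight {zero} c = 0
  weight {suc n} c with c Fin.zero ≟ 0#
  ... | yes _ = weight {n} (λ i → c (Fin.suc i))
  ... | no _  = suc (weight {n} (λ i → c (Fin.suc i)))

  IsZeroVec : {n : ℕ} → (Fin n → Carrier) → Set
  IsZeroVec c = ∀ k → c k ≡ 0#

  _∈Code_ : {k n : ℕ} → (Fin n → Carrier) → (Fin k → Fin n → Carrier) → Set
  _∈Code_ {k} {n} c G = Σ (Fin k → Carrier) λ u → ∀ j → c j ≡ Σᶠ k (λ i → u i * G i j)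

  HasMinWeight : {k n : ℕ} → (Fin k → Fin n → Carrier) → ℕ → Set
  HasMinWeight {k} {n} G d =
    (Σ (Fin n → Carrier) λ c → c ∈Code G × ¬ IsZeroVec c × weight c ≡ d)
    × (∀ (c : Fin n → Carrier) → c ∈Code G → ¬ IsZeroVec c → d ≤ weight c)

  private
    lt₁ : ∀ {m} (i j : Fin m) → toℕ j ∸ toℕ i < m
    lt₁ i j = ≤-<-trans (m∸n≤m (toℕ j) (toℕ i)) (toℕ<n j)

    lt₂ : ∀ {m} (i j : Fin m) → ¬ (toℕ i ≤ toℕ j) → m +ℕ toℕ j ∸ toℕ i < m
    lt₂ {m} i j i≰j =
      subst (m +ℕ toℕ j ∸ toℕ i <_) (m+n∸n≡m m (toℕ i))
        (∸-monoˡ-< (+-monoʳ-< m (≰⇒> i≰j))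
                   (≤-trans (<⇒≤ (toℕ<n i)) (m≤m+n m (toℕ j))))

  -- A_μ(r): (i,j) entry r_{j-i} if j ≥ i, μ r_{m+j-i} if j < i
  Aμ : {m : ℕ} → Carrier → Vec Carrier m → Fin m → Fin m → Carrier
  Aμ {m} μ r i j with toℕ i ≤? toℕ j
  ... | yes _  = lookup r (fromℕ< (lt₁ i j))
  ... | no i≰j = μ * lookup r (fromℕ< (lt₂ i j i≰j))

  augment : {m : ℕ} → (Fin m → Fin m → Carrier) → Fin m → Fin (m +ℕ m) → Carrier
  augment {m} A i k with splitAt m k
  ... | inj₁ j with i Fin.≟ j
  ...   | yes _ = 1#
  ...   | no _  = 0#
  augment {m} A i k | inj₂ j = A i j

  DCgen : {m : ℕ} → Vec Carrier m → Fin m → Fin (m +ℕ m) → Carrier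
  DCgen r = augment (Aμ 1# r)

  DNgen : {m : ℕ} → Vec Carrier m → Fin m → Fin (m +ℕ m) → Carrier
  DNgen r = augment (Aμ (- 1#) r)

  open import Data.Vec using (tabulate; replicate)
  open import Data.Bool using (if_then_else_)
  open import Data.Nat using (_≡ᵇ_; _<ᵇ_)

  r0000 : (m : ℕ) → Vec Carrier m
  r0000 m = replicate m 0#

  r1000 : (m : ℕ) → Vec Carrier m
  r1000 m = tabulate λ i → if toℕ i ≡ᵇ 0 then 1# else 0#

  r1100 : (m : ℕ) → Vec Carrier m
  r1100 m = tabulate λ i → if toℕ i <ᵇ 2 then 1# else 0#

  r0111 : (m : ℕ) → Vec Carrier m
  r0111 m = tabulate λ i → if toℕ i ≡ᵇ 0 then 0# else 1#

{-# OPTIONS --safe #-}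
module Submission where

-- The code with generator matrix (I | A) consists of the words (u | uA), of weight wt u + wt (uA).
-- For r = (0,…,0) and r = (1,0,…,0) the circulant A is 0 and I, giving minimum weights 1 and 2.
-- For r = (1,1,0,…,0) we have (uA)_j = u_j + u_(j-1), indices mod m. Unless u has full support
-- (weight m ≥ 3), its support is a proper nonempty subset of the cycle ℤ/m, so it has a falling
-- and a rising edge, and uA is nonzero at both. For r = (0,1,…,1) we have (uA)_j = Σu − u_j: if
-- Σu ≠ 0 every coordinate is nonzero in u or in uA (total weight ≥ m ≥ 4); if Σu = 0 then uA = −u,
-- and u has at least two nonzero entries. The three short codes, and the field laws used for
-- F₂, F₃, F₄, are checked by enumeration.

open import Defs
open import Data.Bool using (if_then_else_)
open import Data.Fin using (Fin; zero; suc; toℕ; fromℕ; fromℕ<; inject₁; _↑ˡ_; _↑ʳ_)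
import Data.Fin as Fin
open import Data.Fin.Properties
  using (toℕ-injective; toℕ<n; toℕ-inject₁; toℕ-fromℕ; toℕ-fromℕ<; ≤fromℕ; suc-injective;
         splitAt-↑ˡ; splitAt-↑ʳ; all?; ¬∀⟶∃¬)
open import Data.List using (List; _∷_; [])
open import Data.List.Membership.Propositional using (_∈_)
open import Data.List.Relation.Unary.Any using (here; there)
import Data.List.Relation.Unary.All as All
open import Data.Nat using (ℕ; zero; suc; _∸_; _≤_; _<_; _≤?_; _≡ᵇ_; _<ᵇ_; z≤n; s≤s)
  renaming (_+_ to _+ℕ_)
import Data.Nat.Properties as ℕ
open import Data.Product using (∃; ∃₂; _×_; _,_; proj₁; proj₂; map)
open import Data.Sum using (_⊎_; inj₁; inj₂)
open import Data.Vec using (Vec; lookup; tabulate; replicate; _∷_; [])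
open import Data.Vec.Properties using (lookup∘tabulate; lookup-replicate)
import Data.Vec.Functional as Vector
open import Data.Vec.Functional using (updateAt)
open import Data.Vec.Functional.Properties using (updateAt-updates; updateAt-minimal)
open import Function using (_∘_; _$_; id; const)
open import Relation.Binary.PropositionalEquality
  using (_≡_; _≢_; _≗_; refl; sym; trans; cong; cong₂; subst; module ≡-Reasoning)
open import Relation.Nullary using (¬_; Dec; yes; no; contradiction)
open import Relation.Nullary.Decidable using (map′; ¬?; _×-dec_; _→-dec_; from-yes; decidable-stable)
open import Relation.Unary using (Decidable)

record FieldLaws (F : FieldOps) : Set where
  open FieldOps F
  field
    +-identityˡ : ∀ x → 0# + x ≡ x
    +-comm      : ∀ x y → x + y ≡ y + x
    +-assoc     : ∀ x y z → (x + y) + z ≡ x + (y + z)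
    *-zeroˡ     : ∀ x → 0# * x ≡ 0#
    *-zeroʳ     : ∀ x → x * 0# ≡ 0#
    *-identityˡ : ∀ x → 1# * x ≡ x
    *-identityʳ : ∀ x → x * 1# ≡ x
    1+-1≡0      : 1# + - 1# ≡ 0#
    1≢0         : 1# ≢ 0#

module Exhaustion {C : Set} (elements : List C) (complete : ∀ x → x ∈ elements) where

  ∀? : {P : C → Set} → Decidable P → Dec (∀ x → P x)
  ∀? P? = map′ (λ all x → All.lookup all (complete x)) (λ ∀P → All.tabulate λ {x} _ → ∀P x)
               (All.all? P? elements)

  -- Without function extensionality, only predicates that respect ≗ can be decided this way.
  ∀ᶠ? : ∀ m {P : (Fin m → C) → Set} → (∀ {u v} → u ≗ v → P u → P v) → Decidable P
      → Dec (∀ u → P u)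
  ∀ᶠ? zero    resp P? = map′ (λ p u → resp (λ ()) p) (λ ∀P → ∀P Vector.[]) (P? Vector.[])
  ∀ᶠ? (suc m) resp P? =
    map′ (λ ∀P u → resp (head∷tail u) (∀P (Vector.head u) (Vector.tail u)))
         (λ ∀P x v → ∀P (x Vector.∷ v))
         (∀? λ x → ∀ᶠ? m (resp ∘ cons-cong) (λ v → P? (x Vector.∷ v)))
    where
    head∷tail : (u : Fin (suc m) → C) → Vector.head u Vector.∷ Vector.tail u ≗ u
    head∷tail u zero    = refl
    head∷tail u (suc i) = refl
    cons-cong : ∀ {x} {v w : Fin m → C} → v ≗ w → x Vector.∷ v ≗ x Vector.∷ w
    cons-cong v≗w zero    = refl
    cons-cong v≗w (suc i) = v≗w i

fieldLaws? : (F : FieldOps) (elements : List (FieldOps.Carrier F))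
           → (∀ x → x ∈ elements) → Dec (FieldLaws F)
fieldLaws? F elements complete =
  map′ (λ (a , b , c , d , e , f , g , h , i) → record
         { +-identityˡ = a ; +-comm = b ; +-assoc = c ; *-zeroˡ = d ; *-zeroʳ = e
         ; *-identityˡ = f ; *-identityʳ = g ; 1+-1≡0 = h ; 1≢0 = i })
       (λ L → let open FieldLaws L in
         +-identityˡ , +-comm , +-assoc , *-zeroˡ , *-zeroʳ , *-identityˡ , *-identityʳ , 1+-1≡0 , 1≢0)
       (∀? (λ x → (0# + x) ≟ x)
        ×-dec ∀? (λ x → ∀? λ y → (x + y) ≟ (y + x))
        ×-dec ∀? (λ x → ∀? λ y → ∀? λ z → ((x + y) + z) ≟ (x + (y + z)))
        ×-dec ∀? (λ x → (0# * x) ≟ 0#)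
        ×-dec ∀? (λ x → (x * 0#) ≟ 0#)
        ×-dec ∀? (λ x → (1# * x) ≟ x)
        ×-dec ∀? (λ x → (x * 1#) ≟ x)
        ×-dec (1# + - 1#) ≟ 0#
        ×-dec ¬? (1# ≟ 0#))
  where
  open FieldOps F
  open Exhaustion elements complete

elements : (q : Q) → List (FieldOps.Carrier (𝔽 q))
elements q2 = o2 ∷ i2 ∷ []
elements q3 = o3 ∷ i3 ∷ t3 ∷ []
elements q4 = o4 ∷ i4 ∷ ω ∷ ω² ∷ []

elements-complete : (q : Q) → ∀ x → x ∈ elements q
elements-complete q2 o2 = here refl
elements-complete q2 i2 = there (here refl)
elements-complete q3 o3 = here refl
elements-complete q3 i3 = there (here refl)
elements-complete q3 t3 = there (there (here refl))
elements-complete q4 o4 = here refl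
elements-complete q4 i4 = there (here refl)
elements-complete q4 ω  = there (there (here refl))
elements-complete q4 ω² = there (there (there (here refl)))

fieldLaws : (q : Q) → FieldLaws (𝔽 q)
fieldLaws q2 = from-yes (fieldLaws? (𝔽 q2) (elements q2) (elements-complete q2))
fieldLaws q3 = from-yes (fieldLaws? (𝔽 q3) (elements q3) (elements-complete q3))
fieldLaws q4 = from-yes (fieldLaws? (𝔽 q4) (elements q4) (elements-complete q4))

WrapsTo : ℕ → ℕ → ℕ → Set
WrapsTo m x c = x ≡ c ⊎ x ≡ m +ℕ c

no-wraparound : ∀ {m} a {b} k → b < m → b +ℕ k ≢ m +ℕ (a +ℕ k)
no-wraparound {m} a k b<m eq = ℕ.<⇒≱ b<m
  (subst (m ≤_) (ℕ.+-cancelʳ-≡ k _ _ (trans (ℕ.+-assoc m a k) (sym eq))) (ℕ.m≤m+n m a))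

WrapsTo-injective : ∀ {m a b k c} → a < m → b < m
                  → WrapsTo m (a +ℕ k) c → WrapsTo m (b +ℕ k) c → a ≡ b
WrapsTo-injective {k = k} _ _ (inj₁ a+k≡c) (inj₁ b+k≡c) =
  ℕ.+-cancelʳ-≡ k _ _ (trans a+k≡c (sym b+k≡c))
WrapsTo-injective {k = k} _ _ (inj₂ a+k≡m+c) (inj₂ b+k≡m+c) =
  ℕ.+-cancelʳ-≡ k _ _ (trans a+k≡m+c (sym b+k≡m+c))
WrapsTo-injective {a = a} {k = k} _ b<m (inj₁ a+k≡c) (inj₂ b+k≡m+c) =
  contradiction (trans b+k≡m+c (cong (_ +ℕ_) (sym a+k≡c))) (no-wraparound a k b<m)
WrapsTo-injective a<m b<m (inj₂ a+k≡m+c) (inj₁ b+k≡c) =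
  sym (WrapsTo-injective b<m a<m (inj₁ b+k≡c) (inj₂ a+k≡m+c))

-- offset i j = (j − i) mod m: the (i, j) entry of Aμ μ r is r at index offset i j (times μ if j < i).
offset : ∀ {m} → Fin m → Fin m → ℕ
offset {m} i j with toℕ i ≤? toℕ j
... | yes _ = toℕ j ∸ toℕ i
... | no _  = m +ℕ toℕ j ∸ toℕ i

offset<m : ∀ {m} (i j : Fin m) → offset i j < m
offset<m {m} i j with toℕ i ≤? toℕ j
... | yes _  = ℕ.≤-<-trans (ℕ.m∸n≤m (toℕ j) (toℕ i)) (toℕ<n j)
... | no i≰j = subst (m +ℕ toℕ j ∸ toℕ i <_) (ℕ.m+n∸n≡m m (toℕ i))
  (ℕ.∸-monoˡ-< (ℕ.+-monoʳ-< m (ℕ.≰⇒> i≰j))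
               (ℕ.≤-trans (ℕ.<⇒≤ (toℕ<n i)) (ℕ.m≤m+n m (toℕ j))))

offset-≤ : ∀ {m} {i j : Fin m} → toℕ i ≤ toℕ j → offset i j ≡ toℕ j ∸ toℕ i
offset-≤ {i = i} {j} i≤j with toℕ i ≤? toℕ j
... | yes _  = refl
... | no i≰j = contradiction i≤j i≰j

offset-> : ∀ {m} {i j : Fin m} → toℕ j < toℕ i → offset i j ≡ m +ℕ toℕ j ∸ toℕ i
offset-> {i = i} {j} j<i with toℕ i ≤? toℕ j
... | yes i≤j = contradiction i≤j (ℕ.<⇒≱ j<i)
... | no _    = refl

offset-wraps : ∀ {m} (i j : Fin m) → WrapsTo m (toℕ i +ℕ offset i j) (toℕ j)
offset-wraps {m} i j with toℕ i ≤? toℕ j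
... | yes i≤j = inj₁ (ℕ.m+[n∸m]≡n i≤j)
... | no _    = inj₂ (ℕ.m+[n∸m]≡n (ℕ.≤-trans (ℕ.<⇒≤ (toℕ<n i)) (ℕ.m≤m+n m (toℕ j))))

offset-injectiveˡ : ∀ {m} {i p : Fin m} (j : Fin m) → offset i j ≡ offset p j → i ≡ p
offset-injectiveˡ {m} {i} {p} j eq = toℕ-injective (WrapsTo-injective (toℕ<n i) (toℕ<n p)
  (offset-wraps i j) (subst (λ k → WrapsTo m (toℕ p +ℕ k) (toℕ j)) (sym eq) (offset-wraps p j)))

offset-self : ∀ {m} (i : Fin m) → offset i i ≡ 0
offset-self i = trans (offset-≤ {i = i} ℕ.≤-refl) (ℕ.n∸n≡0 (toℕ i))

offset≡0⇒≡ : ∀ {m} {i j : Fin m} → offset i j ≡ 0 → i ≡ j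
offset≡0⇒≡ {j = j} eq = offset-injectiveˡ j (trans eq (sym (offset-self j)))

offset-inject₁-suc : ∀ {n} (i : Fin n) → offset (inject₁ i) (suc i) ≡ 1
offset-inject₁-suc i = begin
  offset (inject₁ i) (suc i)     ≡⟨ offset-≤ {i = inject₁ i} {suc i} i≤1+i ⟩
  suc (toℕ i) ∸ toℕ (inject₁ i)  ≡⟨ cong (suc (toℕ i) ∸_) (toℕ-inject₁ i) ⟩
  suc (toℕ i) ∸ toℕ i            ≡⟨ ℕ.m+n∸n≡m 1 (toℕ i) ⟩
  1                              ∎
  where
  open ≡-Reasoning
  i≤1+i : toℕ (inject₁ i) ≤ suc (toℕ i)
  i≤1+i = ℕ.≤-trans (ℕ.≤-reflexive (toℕ-inject₁ i)) (ℕ.n≤1+n _)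

offset-fromℕ-zero : ∀ n → offset (fromℕ (suc n)) zero ≡ 1
offset-fromℕ-zero n = begin
  offset (fromℕ (suc n)) zero             ≡⟨ offset-> {i = fromℕ (suc n)} {zero} (s≤s z≤n) ⟩
  suc (suc n) +ℕ 0 ∸ toℕ (fromℕ (suc n))  ≡⟨ cong₂ _∸_ (ℕ.+-identityʳ (suc (suc n)))
                                                        (toℕ-fromℕ (suc n)) ⟩
  suc (suc n) ∸ suc n                     ≡⟨ ℕ.m+n∸n≡m 1 (suc n) ⟩
  1                                       ∎
  where open ≡-Reasoning

falling-edge : ∀ {n} (P : Fin (suc n) → Set) → Decidable P
             → ∀ {a b} → toℕ a ≤ toℕ b → P a → ¬ P b
             → ∃ λ i → P (inject₁ i) × ¬ P (suc i)
falling-edge P P? {zero} {zero} _ pa ¬pb = contradiction pa ¬pb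
falling-edge {suc n} P P? {zero} {suc b} _ pa ¬pb with P? (suc zero)
... | no ¬p₁ = zero , pa , ¬p₁
... | yes p₁ = map suc id (falling-edge (P ∘ suc) (P? ∘ suc) {zero} {b} z≤n p₁ ¬pb)
falling-edge {suc n} P P? {suc a} {suc b} (s≤s a≤b) pa ¬pb =
  map suc id (falling-edge (P ∘ suc) (P? ∘ suc) a≤b pa ¬pb)

CyclicFallingEdge : ∀ {m} → (Fin m → Set) → Set
CyclicFallingEdge P = ∃₂ λ p j → offset p j ≡ 1 × P p × ¬ P j

cyclic-falling-edge : ∀ {m} (P : Fin m → Set) → Decidable P
                    → ∀ {a b} → P a → ¬ P b → CyclicFallingEdge P
cyclic-falling-edge {suc n} P P? {a} {b} pa ¬pb = edge (P? zero) (P? (fromℕ n))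
  where
  linear : (∃ λ i → P (inject₁ i) × ¬ P (suc i)) → CyclicFallingEdge P
  linear (i , pᵢ , ¬pᵢ₊₁) = inject₁ i , suc i , offset-inject₁-suc i , pᵢ , ¬pᵢ₊₁
  wraparound : ∀ {n} (P : Fin (suc n) → Set) → ¬ P zero → P (fromℕ n) → CyclicFallingEdge P
  wraparound {zero}  P ¬p₀ pₙ = contradiction pₙ ¬p₀
  wraparound {suc n} P ¬p₀ pₙ = fromℕ (suc n) , zero , offset-fromℕ-zero n , pₙ , ¬p₀
  edge : Dec (P zero) → Dec (P (fromℕ n)) → CyclicFallingEdge P
  edge (yes p₀) _        = linear (falling-edge P P? z≤n p₀ ¬pb)
  edge (no _)   (no ¬pₙ) = linear (falling-edge P P? (≤fromℕ a) pa ¬pₙ)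
  edge (no ¬p₀) (yes pₙ) = wraparound P ¬p₀ pₙ

module Codes (F : FieldOps) (L : FieldLaws F) where
  open FieldOps F
  open FieldLaws L
  open ≡-Reasoning

  Matrix : ℕ → Set
  Matrix m = Fin m → Fin m → Carrier

  sum : (m : ℕ) → (Fin m → Carrier) → Carrier
  sum = Σᶠ F

  wt : ∀ {n} → (Fin n → Carrier) → ℕ
  wt = weight F

  +-identityʳ : ∀ x → x + 0# ≡ x
  +-identityʳ x = trans (+-comm x 0#) (+-identityˡ x)

  x+y≡0∧x≡0⇒y≡0 : ∀ {x y} → x + y ≡ 0# → x ≡ 0# → y ≡ 0#
  x+y≡0∧x≡0⇒y≡0 {x} {y} x+y≡0 x≡0 =
    trans (sym (+-identityˡ y)) (trans (cong (_+ y) (sym x≡0)) x+y≡0)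

  -1≢0 : - 1# ≢ 0#
  -1≢0 -1≡0 = 1≢0 (x+y≡0∧x≡0⇒y≡0 (trans (+-comm _ _) 1+-1≡0) -1≡0)

  sum-cong : ∀ m {f g : Fin m → Carrier} → f ≗ g → sum m f ≡ sum m g
  sum-cong zero    _   = refl
  sum-cong (suc m) f≗g = cong₂ _+_ (f≗g zero) (sum-cong m (f≗g ∘ suc))

  sum-zero : ∀ m {f : Fin m → Carrier} → IsZeroVec F f → sum m f ≡ 0#
  sum-zero zero    _   = refl
  sum-zero (suc m) f≡0 = trans (cong₂ _+_ (f≡0 zero) (sum-zero m (f≡0 ∘ suc))) (+-identityˡ 0#)

  sum-split-at : ∀ m (f g : Fin m → Carrier) (k : Fin m) → g k ≡ 0# → (∀ i → i ≢ k → g i ≡ f i)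
               → sum m f ≡ sum m g + f k
  sum-split-at (suc m) f g zero g₀≡0 agree = begin
    f zero + sum m (f ∘ suc)           ≡⟨ +-comm _ _ ⟩
    sum m (f ∘ suc) + f zero           ≡⟨ cong (_+ f zero) (sum-cong m λ i → sym (agree (suc i) λ ())) ⟩
    sum m (g ∘ suc) + f zero           ≡⟨ cong (_+ f zero) (sym (+-identityˡ _)) ⟩
    0# + sum m (g ∘ suc) + f zero      ≡⟨ cong (λ x → x + sum m (g ∘ suc) + f zero) (sym g₀≡0) ⟩
    g zero + sum m (g ∘ suc) + f zero  ∎
  sum-split-at (suc m) f g (suc k) gₖ≡0 agree = begin
    f zero + sum m (f ∘ suc)                ≡⟨ cong (f zero +_) (sum-split-at m (f ∘ suc) (g ∘ suc) k
                                                 gₖ≡0 λ i i≢k → agree (suc i) (i≢k ∘ suc-injective)) ⟩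
    f zero + (sum m (g ∘ suc) + f (suc k))  ≡⟨ sym (+-assoc _ _ _) ⟩
    f zero + sum m (g ∘ suc) + f (suc k)    ≡⟨ cong (λ x → x + sum m (g ∘ suc) + f (suc k))
                                                    (sym (agree zero λ ())) ⟩
    g zero + sum m (g ∘ suc) + f (suc k)    ∎

  sum-single : ∀ m {f : Fin m → Carrier} (k : Fin m) → (∀ i → i ≢ k → f i ≡ 0#) → sum m f ≡ f k
  sum-single m {f} k vanish = begin
    sum m f                 ≡⟨ sum-split-at m f (const 0#) k refl (λ i i≢k → sym (vanish i i≢k)) ⟩
    sum m (const 0#) + f k  ≡⟨ cong (_+ f k) (sum-zero m λ _ → refl) ⟩
    0# + f k                ≡⟨ +-identityˡ _ ⟩
    f k                     ∎

  sum-pair : ∀ m {f : Fin m → Carrier} {j p : Fin m}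
           → j ≢ p → (∀ i → i ≢ j → i ≢ p → f i ≡ 0#)
           → sum m f ≡ f j + f p
  sum-pair m {f} {j} {p} j≢p vanish = begin
    sum m f         ≡⟨ sum-split-at m f f′ p (updateAt-updates p f)
                                     (λ i i≢p → updateAt-minimal i p f i≢p) ⟩
    sum m f′ + f p  ≡⟨ cong (_+ f p) (sum-single m j vanish′) ⟩
    f′ j + f p      ≡⟨ cong (_+ f p) (updateAt-minimal j p f j≢p) ⟩
    f j + f p       ∎
    where
    f′ : Fin m → Carrier
    f′ = updateAt f p (const 0#)
    vanish′ : ∀ i → i ≢ j → f′ i ≡ 0#
    vanish′ i i≢j with i Fin.≟ p
    ... | yes refl = updateAt-updates p f
    ... | no i≢p   = trans (updateAt-minimal i p f i≢p) (vanish i i≢j i≢p)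

  nonzero-entry : ∀ {n} {u : Fin n → Carrier} → ¬ IsZeroVec F u → ∃ λ k → u k ≢ 0#
  nonzero-entry {n} {u} = ¬∀⟶∃¬ n _ λ k → u k ≟ 0#

  weight-head-zero : ∀ {n} (u : Fin (suc n) → Carrier) → u zero ≡ 0# → wt u ≡ wt (u ∘ suc)
  weight-head-zero u u₀≡0 with u zero ≟ 0#
  ... | yes _   = refl
  ... | no u₀≢0 = contradiction u₀≡0 u₀≢0

  weight-head-nonzero : ∀ {n} (u : Fin (suc n) → Carrier) → u zero ≢ 0# → wt u ≡ suc (wt (u ∘ suc))
  weight-head-nonzero u u₀≢0 with u zero ≟ 0#
  ... | yes u₀≡0 = contradiction u₀≡0 u₀≢0
  ... | no _     = refl

  weight-support : ∀ {n} {u v : Fin n → Carrier}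
                 → (∀ k → (u k ≡ 0# → v k ≡ 0#) × (v k ≡ 0# → u k ≡ 0#)) → wt u ≡ wt v
  weight-support {zero} _ = refl
  weight-support {suc n} {u} {v} same with u zero ≟ 0# | v zero ≟ 0#
  ... | yes _    | yes _    = weight-support (same ∘ suc)
  ... | no _     | no _     = cong suc (weight-support (same ∘ suc))
  ... | yes u₀≡0 | no v₀≢0  = contradiction (proj₁ (same zero) u₀≡0) v₀≢0
  ... | no u₀≢0  | yes v₀≡0 = contradiction (proj₂ (same zero) v₀≡0) u₀≢0

  weight-cong : ∀ {n} {u v : Fin n → Carrier} → u ≗ v → wt u ≡ wt v
  weight-cong u≗v = weight-support λ k → trans (sym (u≗v k)) , trans (u≗v k)

  weight-zero : ∀ {n} {u : Fin n → Carrier} → IsZeroVec F u → wt u ≡ 0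
  weight-zero {zero}  _   = refl
  weight-zero {suc n} {u} u≡0 = trans (weight-head-zero u (u≡0 zero)) (weight-zero (u≡0 ∘ suc))

  1≤weight : ∀ {n} (u : Fin n → Carrier) {k} → u k ≢ 0# → 1 ≤ wt u
  1≤weight u {zero} u₀≢0 = subst (1 ≤_) (sym (weight-head-nonzero u u₀≢0)) (s≤s z≤n)
  1≤weight u {suc k} uₖ≢0 with u zero ≟ 0#
  ... | yes _ = 1≤weight (u ∘ suc) uₖ≢0
  ... | no _  = s≤s z≤n

  2≤weight : ∀ {n} (u : Fin n → Carrier) {a b} → a ≢ b → u a ≢ 0# → u b ≢ 0# → 2 ≤ wt u
  2≤weight u {zero}  {zero}  a≢b _ _ = contradiction refl a≢b
  2≤weight u {suc a} {zero}  a≢b uₐ≢0 u₀≢0 = 2≤weight u (a≢b ∘ sym) u₀≢0 uₐ≢0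
  2≤weight u {zero}  {suc b} _ u₀≢0 u_b≢0 =
    subst (2 ≤_) (sym (weight-head-nonzero u u₀≢0)) (s≤s (1≤weight (u ∘ suc) u_b≢0))
  2≤weight u {suc a} {suc b} a≢b uₐ≢0 u_b≢0 with u zero ≟ 0#
  ... | yes _ = 2≤weight (u ∘ suc) (a≢b ∘ cong suc) uₐ≢0 u_b≢0
  ... | no _  = s≤s (1≤weight (u ∘ suc) uₐ≢0)

  2≤weight-of-sum-zero : ∀ {m} (u : Fin m → Carrier) {k} → sum m u ≡ 0# → u k ≢ 0# → 2 ≤ wt u
  2≤weight-of-sum-zero {m} u {k} S≡0 uₖ≢0 = second-entry (all? λ i → u′ i ≟ 0#)
    where
    u′ : Fin m → Carrier
    u′ = updateAt u k (const 0#)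
    split : sum m u ≡ sum m u′ + u k
    split = sum-split-at m u u′ k (updateAt-updates k u) (λ i i≢k → updateAt-minimal i k u i≢k)
    second-entry : Dec (IsZeroVec F u′) → 2 ≤ wt u
    second-entry (yes u′≡0) =
      contradiction (x+y≡0∧x≡0⇒y≡0 (trans (sym split) S≡0) (sum-zero m u′≡0)) uₖ≢0
    second-entry (no u′≢0) with nonzero-entry u′≢0
    ... | i , u′ᵢ≢0 =
      2≤weight u k≢i uₖ≢0 (u′ᵢ≢0 ∘ trans (updateAt-minimal i k u (k≢i ∘ sym)))
      where
      k≢i : k ≢ i
      k≢i refl = u′ᵢ≢0 (updateAt-updates k u)

  weight-cover : ∀ {n} (u v : Fin n → Carrier) → (∀ k → u k ≢ 0# ⊎ v k ≢ 0#) → n ≤ wt u +ℕ wt v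
  weight-cover {zero} _ _ _ = z≤n
  weight-cover {suc n} u v cover with u zero ≟ 0# | v zero ≟ 0# | cover zero
  ... | yes u₀≡0 | _        | inj₁ u₀≢0 = contradiction u₀≡0 u₀≢0
  ... | _        | yes v₀≡0 | inj₂ v₀≢0 = contradiction v₀≡0 v₀≢0
  ... | no _     | yes _    | _ = s≤s (weight-cover (u ∘ suc) (v ∘ suc) (cover ∘ suc))
  ... | yes _    | no _     | _ = subst (suc n ≤_) (sym (ℕ.+-suc _ _))
                                    (s≤s (weight-cover (u ∘ suc) (v ∘ suc) (cover ∘ suc)))
  ... | no _     | no _     | _ = s≤s (ℕ.≤-trans (weight-cover (u ∘ suc) (v ∘ suc) (cover ∘ suc))
                                                 (ℕ.+-monoʳ-≤ (wt (u ∘ suc)) (ℕ.n≤1+n _)))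

  weight-splitAt : ∀ m {n} (c : Fin (m +ℕ n) → Carrier)
                 → wt c ≡ wt (c ∘ (_↑ˡ n)) +ℕ wt (c ∘ (m ↑ʳ_))
  weight-splitAt zero    c = refl
  weight-splitAt (suc m) c with c zero ≟ 0#
  ... | yes _ = weight-splitAt m (c ∘ suc)
  ... | no _  = cong suc (weight-splitAt m (c ∘ suc))

  _*ᴹ_ : ∀ {m} → (Fin m → Carrier) → Matrix m → Fin m → Carrier
  (u *ᴹ A) j = sum _ λ i → u i * A i j

  *ᴹ-cong : ∀ {m} (A : Matrix m) {u v : Fin m → Carrier} → u ≗ v → u *ᴹ A ≗ v *ᴹ A
  *ᴹ-cong {m} A u≗v j = sum-cong m λ i → cong (_* A i j) (u≗v i)

  encode : ∀ {m} → Matrix m → (Fin m → Carrier) → Fin (m +ℕ m) → Carrier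
  encode {m} A u k = sum m λ i → u i * augment F A i k

  encode-↑ˡ : ∀ {m} (A : Matrix m) u k → encode A u (k ↑ˡ m) ≡ u k
  encode-↑ˡ {m} A u k = begin
    encode A u (k ↑ˡ m)           ≡⟨ sum-single m k (λ i i≢k →
                                       trans (cong (u i *_) (off-diagonal i≢k)) (*-zeroʳ _)) ⟩
    u k * augment F A k (k ↑ˡ m)  ≡⟨ cong (u k *_) diagonal ⟩
    u k * 1#                      ≡⟨ *-identityʳ _ ⟩
    u k                           ∎
    where
    diagonal : augment F A k (k ↑ˡ m) ≡ 1#
    diagonal rewrite splitAt-↑ˡ m k m with k Fin.≟ k
    ... | yes _  = refl
    ... | no k≢k = contradiction refl k≢k
    off-diagonal : ∀ {i} → i ≢ k → augment F A i (k ↑ˡ m) ≡ 0#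
    off-diagonal {i} i≢k rewrite splitAt-↑ˡ m k m with i Fin.≟ k
    ... | yes i≡k = contradiction i≡k i≢k
    ... | no _    = refl

  encode-↑ʳ : ∀ {m} (A : Matrix m) u j → encode A u (m ↑ʳ j) ≡ (u *ᴹ A) j
  encode-↑ʳ {m} A u j = sum-cong m λ i → cong (u i *_) (augment-↑ʳ i)
    where
    augment-↑ʳ : ∀ i → augment F A i (m ↑ʳ j) ≡ A i j
    augment-↑ʳ i rewrite splitAt-↑ʳ m m j = refl

  weight-encode : ∀ {m} (A : Matrix m) u → wt (encode A u) ≡ wt u +ℕ wt (u *ᴹ A)
  weight-encode {m} A u = trans (weight-splitAt m (encode A u))
    (cong₂ _+ℕ_ (weight-cong (encode-↑ˡ A u)) (weight-cong (encode-↑ʳ A u)))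

  LowerBound : ∀ {m} → Matrix m → ℕ → Set
  LowerBound A d = ∀ u → ¬ IsZeroVec F u → d ≤ wt u +ℕ wt (u *ᴹ A)

  hasMinWeight-systematic : ∀ {m} (A : Matrix m) d
                          → (∃₂ λ u k → u k ≢ 0# × wt u +ℕ wt (u *ᴹ A) ≡ d) → LowerBound A d
                          → HasMinWeight F (augment F A) d
  hasMinWeight-systematic {m} A d (u , k , uₖ≢0 , weight≡d) lowerBound =
    (encode A u , (u , λ _ → refl) , encoded≢0 , trans (weight-encode A u) weight≡d) , minimal
    where
    encoded≢0 : ¬ IsZeroVec F (encode A u)
    encoded≢0 c≡0 = uₖ≢0 (trans (sym (encode-↑ˡ A u k)) (c≡0 (k ↑ˡ m)))
    minimal : ∀ c → _∈Code_ F c (augment F A) → ¬ IsZeroVec F c → d ≤ wt c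
    minimal c (v , c≗) c≢0 =
      subst (d ≤_) (sym (trans (weight-cong c≗) (weight-encode A v))) (lowerBound v v≢0)
      where
      v≢0 : ¬ IsZeroVec F v
      v≢0 v≡0 = c≢0 λ j → trans (c≗ j) (sum-zero m λ i → trans (cong (_* _) (v≡0 i)) (*-zeroˡ _))

  module _ (elements : List Carrier) (complete : ∀ x → x ∈ elements) where
    open Exhaustion elements complete

    lowerBound? : ∀ {m} (A : Matrix m) d → Dec (LowerBound A d)
    lowerBound? {m} A d =
      ∀ᶠ? m respects λ u → ¬? (all? λ k → u k ≟ 0#) →-dec (d ≤? wt u +ℕ wt (u *ᴹ A))
      where
      respects : ∀ {u v} → u ≗ v → (¬ IsZeroVec F u → d ≤ wt u +ℕ wt (u *ᴹ A))
                                 → (¬ IsZeroVec F v → d ≤ wt v +ℕ wt (v *ᴹ A))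
      respects u≗v bound v≢0 =
        subst (d ≤_) (cong₂ _+ℕ_ (weight-cong u≗v) (weight-cong (*ᴹ-cong A u≗v)))
              (bound λ u≡0 → v≢0 λ k → trans (sym (u≗v k)) (u≡0 k))

  e₀ : ∀ {n} → Fin (suc n) → Carrier
  e₀ zero    = 1#
  e₀ (suc _) = 0#

  weight-e₀ : ∀ {n} → wt (e₀ {n}) ≡ 1
  weight-e₀ {n} =
    trans (weight-head-nonzero e₀ 1≢0) (cong suc (weight-zero {u = e₀ {n} ∘ suc} λ _ → refl))

  e₀-*ᴹ : ∀ {n} (A : Matrix (suc n)) → e₀ *ᴹ A ≗ A zero
  e₀-*ᴹ A j = trans (sum-single _ zero vanish) (*-identityˡ _)
    where
    vanish : ∀ i → i ≢ zero → e₀ i * A i j ≡ 0#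
    vanish zero    i≢0 = contradiction refl i≢0
    vanish (suc i) _   = *-zeroˡ _

  IdentityPlusShift : ∀ {m} → Matrix m → Set
  IdentityPlusShift A = ∀ u {p j} → offset p j ≡ 1 → (u *ᴹ A) j ≡ u j + u p

  2≤weight-boundary : ∀ {m} (A : Matrix m) → IdentityPlusShift A
                    → ∀ u {a b} → u a ≢ 0# → u b ≡ 0# → 2 ≤ wt (u *ᴹ A)
  2≤weight-boundary A shift u uₐ≢0 u_b≡0
    with cyclic-falling-edge (λ i → u i ≢ 0#) (λ i → ¬? (u i ≟ 0#)) uₐ≢0 (_$ u_b≡0)
       | cyclic-falling-edge (λ i → u i ≡ 0#) (λ i → u i ≟ 0#) u_b≡0 uₐ≢0
  ... | p₁ , j₁ , p₁↦j₁ , u_p₁≢0 , ¬u_j₁≢0 | p₂ , j₂ , p₂↦j₂ , u_p₂≡0 , u_j₂≢0 =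
    2≤weight (u *ᴹ A) j₁≢j₂ (u_p₁≢0 ∘ trans (sym uA₁≡u_p₁)) (u_j₂≢0 ∘ trans (sym uA₂≡u_j₂))
    where
    u_j₁≡0 : u j₁ ≡ 0#
    u_j₁≡0 = decidable-stable (u j₁ ≟ 0#) ¬u_j₁≢0
    uA₁≡u_p₁ : (u *ᴹ A) j₁ ≡ u p₁
    uA₁≡u_p₁ = trans (shift u p₁↦j₁) (trans (cong (_+ u p₁) u_j₁≡0) (+-identityˡ _))
    uA₂≡u_j₂ : (u *ᴹ A) j₂ ≡ u j₂
    uA₂≡u_j₂ = trans (shift u p₂↦j₂) (trans (cong (u j₂ +_) u_p₂≡0) (+-identityʳ _))
    j₁≢j₂ : j₁ ≢ j₂
    j₁≢j₂ refl = u_j₂≢0 u_j₁≡0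

  identityPlusShift-lowerBound : ∀ {m} (A : Matrix m) → 3 ≤ m → IdentityPlusShift A → LowerBound A 3
  identityPlusShift-lowerBound {m} A 3≤m shift u u≢0 with all? (λ k → ¬? (u k ≟ 0#))
  ... | yes full = ℕ.≤-trans 3≤m (weight-cover u (u *ᴹ A) (inj₁ ∘ full))
  ... | no ¬full with nonzero-entry u≢0 | ¬∀⟶∃¬ m _ (λ k → ¬? (u k ≟ 0#)) ¬full
  ...   | k , uₖ≢0 | z , ¬u_z≢0 = ℕ.+-mono-≤ (1≤weight u uₖ≢0)
          (2≤weight-boundary A shift u uₖ≢0 (decidable-stable (u z ≟ 0#) ¬u_z≢0))

  AllOnesMinusIdentity : ∀ {m} → Matrix m → Set
  AllOnesMinusIdentity {m} A = ∀ u j → sum m u ≡ (u *ᴹ A) j + u j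

  weight-allOnesMinusIdentity : ∀ {m} (A : Matrix m) → AllOnesMinusIdentity A
                              → ∀ u → sum m u ≡ 0# → wt (u *ᴹ A) ≡ wt u
  weight-allOnesMinusIdentity A complement u S≡0 = weight-support λ j →
    let uAⱼ+uⱼ≡0 = trans (sym (complement u j)) S≡0 in
    x+y≡0∧x≡0⇒y≡0 uAⱼ+uⱼ≡0 , x+y≡0∧x≡0⇒y≡0 (trans (+-comm _ _) uAⱼ+uⱼ≡0)

  allOnesMinusIdentity-lowerBound : ∀ {m} (A : Matrix m) → 4 ≤ m → AllOnesMinusIdentity A → LowerBound A 4
  allOnesMinusIdentity-lowerBound {m} A 4≤m complement u u≢0 with sum m u ≟ 0# | nonzero-entry u≢0
  ... | no S≢0 | _ = ℕ.≤-trans 4≤m (weight-cover u (u *ᴹ A) cover)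
    where
    cover : ∀ j → u j ≢ 0# ⊎ (u *ᴹ A) j ≢ 0#
    cover j with u j ≟ 0#
    ... | no uⱼ≢0  = inj₁ uⱼ≢0
    ... | yes uⱼ≡0 = inj₂ λ uAⱼ≡0 →
      S≢0 (trans (complement u j) (trans (cong₂ _+_ uAⱼ≡0 uⱼ≡0) (+-identityˡ 0#)))
  ... | yes S≡0 | k , uₖ≢0 =
    subst (4 ≤_) (cong (wt u +ℕ_) (sym (weight-allOnesMinusIdentity A complement u S≡0)))
          (ℕ.+-mono-≤ (2≤weight-of-sum-zero u S≡0 uₖ≢0) (2≤weight-of-sum-zero u S≡0 uₖ≢0))

  circulant-lookup : ∀ {m} (r : Vec Carrier m) (i j : Fin m)
                   → Aμ F 1# r i j ≡ lookup r (fromℕ< (offset<m i j))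
  circulant-lookup r i j with toℕ i ≤? toℕ j
  ... | yes _ = refl
  ... | no _  = *-identityˡ _

  circulant-tabulate : ∀ {m} (h : ℕ → Carrier) (i j : Fin m)
                     → Aμ F 1# (tabulate (h ∘ toℕ)) i j ≡ h (offset i j)
  circulant-tabulate h i j = trans (circulant-lookup _ i j)
    (trans (lookup∘tabulate (h ∘ toℕ) _) (cong h (toℕ-fromℕ< (offset<m i j))))

  circulant-replicate : ∀ {m} x (i j : Fin m) → Aμ F 1# (replicate m x) i j ≡ x
  circulant-replicate x i j = trans (circulant-lookup _ i j) (lookup-replicate (fromℕ< (offset<m i j)) x)

  minWeight-r0000 : ∀ m → 1 ≤ m → HasMinWeight F (DCgen F (r0000 F m)) 1
  minWeight-r0000 (suc n) _ = hasMinWeight-systematic A 1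
    (e₀ , zero , 1≢0 , cong₂ _+ℕ_ weight-e₀ (weight-zero (uA≡0 e₀)))
    (λ u u≢0 → ℕ.≤-trans (1≤weight u (proj₂ (nonzero-entry u≢0))) (ℕ.m≤m+n _ _))
    where
    A : Matrix (suc n)
    A = Aμ F 1# (r0000 F (suc n))
    uA≡0 : ∀ u → IsZeroVec F (u *ᴹ A)
    uA≡0 u j = sum-zero _ λ i → trans (cong (u i *_) (circulant-replicate 0# i j)) (*-zeroʳ _)

  minWeight-r1000 : ∀ m → 1 ≤ m → HasMinWeight F (DCgen F (r1000 F m)) 2
  minWeight-r1000 (suc n) _ = hasMinWeight-systematic A 2
    (e₀ , zero , 1≢0 , cong₂ _+ℕ_ weight-e₀ (trans (weight-cong (uA≗u e₀)) weight-e₀))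
    (λ u u≢0 → let 1≤wt-u = 1≤weight u (proj₂ (nonzero-entry u≢0)) in
      subst (2 ≤_) (cong (wt u +ℕ_) (sym (weight-cong (uA≗u u)))) (ℕ.+-mono-≤ 1≤wt-u 1≤wt-u))
    where
    h : ℕ → Carrier
    h k = if k ≡ᵇ 0 then 1# else 0#
    A : Matrix (suc n)
    A = Aμ F 1# (r1000 F (suc n))
    h-positive : ∀ k → k ≢ 0 → h k ≡ 0#
    h-positive zero    k≢0 = contradiction refl k≢0
    h-positive (suc k) _   = refl
    uA≗u : ∀ u → u *ᴹ A ≗ u
    uA≗u u j = begin
      (u *ᴹ A) j   ≡⟨ sum-single _ j (λ i i≢j →
                                      trans (cong (u i *_) (off-diagonal i≢j)) (*-zeroʳ _)) ⟩
      u j * A j j  ≡⟨ cong (u j *_) (trans (circulant-tabulate h j j) (cong h (offset-self j))) ⟩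
      u j * 1#     ≡⟨ *-identityʳ _ ⟩
      u j          ∎
      where
      off-diagonal : ∀ {i} → i ≢ j → A i j ≡ 0#
      off-diagonal {i} i≢j = trans (circulant-tabulate h i j) (h-positive _ (i≢j ∘ offset≡0⇒≡))

  minWeight-r1100 : ∀ m → 3 ≤ m → HasMinWeight F (DCgen F (r1100 F m)) 3
  minWeight-r1100 m@(suc (suc (suc n))) 3≤m@(s≤s (s≤s (s≤s _))) = hasMinWeight-systematic A 3
    (e₀ , zero , 1≢0 , cong₂ _+ℕ_ weight-e₀ (trans (weight-cong e₀A≗h) weight-h))
    (identityPlusShift-lowerBound A 3≤m shift)
    where
    h : ℕ → Carrier
    h k = if k <ᵇ 2 then 1# else 0#
    A : Matrix m
    A = Aμ F 1# (r1100 F m)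
    h-beyond : ∀ k → k ≢ 0 → k ≢ 1 → h k ≡ 0#
    h-beyond zero          k≢0 _   = contradiction refl k≢0
    h-beyond (suc zero)    _   k≢1 = contradiction refl k≢1
    h-beyond (suc (suc k)) _   _   = refl
    e₀A≗h : e₀ *ᴹ A ≗ h ∘ toℕ
    e₀A≗h j =
      trans (e₀-*ᴹ A j) (trans (circulant-tabulate h zero j) (cong h (offset-≤ {i = zero} {j} z≤n)))
    weight-h : wt (h ∘ toℕ {m}) ≡ 2
    weight-h = trans (weight-head-nonzero _ 1≢0) (cong suc (trans (weight-head-nonzero _ 1≢0)
                 (cong suc (weight-zero {u = λ (i : Fin (suc n)) → h (2 +ℕ toℕ i)} λ _ → refl))))
    shift : IdentityPlusShift A
    shift u {p} {j} p↦j = begin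
      (u *ᴹ A) j                 ≡⟨ sum-pair m j≢p vanish ⟩
      u j * A j j + u p * A p j  ≡⟨ cong₂ (λ x y → u j * x + u p * y)
                                          (entry j (offset-self j)) (entry p p↦j) ⟩
      u j * 1# + u p * 1#        ≡⟨ cong₂ _+_ (*-identityʳ _) (*-identityʳ _) ⟩
      u j + u p                  ∎
      where
      entry : ∀ i {k} → offset i j ≡ k → A i j ≡ h k
      entry i eq = trans (circulant-tabulate h i j) (cong h eq)
      j≢p : j ≢ p
      j≢p refl = contradiction (trans (sym (offset-self j)) p↦j) λ ()
      vanish : ∀ i → i ≢ j → i ≢ p → u i * A i j ≡ 0#
      vanish i i≢j i≢p = trans (cong (u i *_) (trans (circulant-tabulate h i j) (h-beyond _ offset≢0 offset≢1)))
                               (*-zeroʳ _)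
        where
        offset≢0 : offset i j ≢ 0
        offset≢0 = i≢j ∘ offset≡0⇒≡
        offset≢1 : offset i j ≢ 1
        offset≢1 i↦j = i≢p (offset-injectiveˡ j (trans i↦j (sym p↦j)))

  minWeight-r0111 : ∀ m → 4 ≤ m → HasMinWeight F (DCgen F (r0111 F m)) 4
  minWeight-r0111 m@(suc (suc n)) 4≤m@(s≤s (s≤s _)) = hasMinWeight-systematic A 4
    (u , zero , 1≢0 , trans (cong (wt u +ℕ_) (weight-allOnesMinusIdentity A complement u sum≡0))
                            (cong₂ _+ℕ_ weight-u weight-u))
    (allOnesMinusIdentity-lowerBound A 4≤m complement)
    where
    h : ℕ → Carrier
    h k = if k ≡ᵇ 0 then 0# else 1#
    A : Matrix m
    A = Aμ F 1# (r0111 F m)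
    h-positive : ∀ k → k ≢ 0 → h k ≡ 1#
    h-positive zero    k≢0 = contradiction refl k≢0
    h-positive (suc k) _   = refl
    complement : AllOnesMinusIdentity A
    complement v j = sum-split-at m v (λ i → v i * A i j) j
      (trans (cong (v j *_) (trans (circulant-tabulate h j j) (cong h (offset-self j)))) (*-zeroʳ _))
      (λ i i≢j → trans (cong (v i *_) (trans (circulant-tabulate h i j)
                                             (h-positive _ (i≢j ∘ offset≡0⇒≡))))
                       (*-identityʳ _))
    u : Fin m → Carrier
    u zero          = 1#
    u (suc zero)    = - 1#
    u (suc (suc _)) = 0#
    sum≡0 : sum m u ≡ 0#
    sum≡0 = begin
      1# + (- 1# + sum n (λ _ → 0#))  ≡⟨ cong (λ x → 1# + (- 1# + x)) (sum-zero n λ _ → refl) ⟩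
      1# + (- 1# + 0#)                ≡⟨ cong (1# +_) (+-identityʳ _) ⟩
      1# + - 1#                       ≡⟨ 1+-1≡0 ⟩
      0#                              ∎
    weight-u : wt u ≡ 2
    weight-u = trans (weight-head-nonzero u 1≢0) (cong suc (trans (weight-head-nonzero _ -1≢0)
                 (cong suc (weight-zero {u = λ (_ : Fin n) → 0#} λ _ → refl))))

minWeight-ternaryN11 : HasMinWeight GF3 (DNgen GF3 (i3 ∷ i3 ∷ [])) 3
minWeight-ternaryN11 = hasMinWeight-systematic A 3 (lookup (i3 ∷ o3 ∷ []) , zero , (λ ()) , refl)
  (from-yes (lowerBound? (elements q3) (elements-complete q3) A 3))
  where
  open Codes GF3 (fieldLaws q3)
  A : Matrix 2
  A = Aμ GF3 t3 (i3 ∷ i3 ∷ [])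

minWeight-quaternaryC1ω : HasMinWeight GF4 (DCgen GF4 (i4 ∷ ω ∷ [])) 3
minWeight-quaternaryC1ω = hasMinWeight-systematic A 3 (lookup (i4 ∷ o4 ∷ []) , zero , (λ ()) , refl)
  (from-yes (lowerBound? (elements q4) (elements-complete q4) A 3))
  where
  open Codes GF4 (fieldLaws q4)
  A : Matrix 2
  A = Aμ GF4 i4 (i4 ∷ ω ∷ [])

minWeight-quaternaryC1ω1 : HasMinWeight GF4 (DCgen GF4 (i4 ∷ ω ∷ i4 ∷ [])) 4
minWeight-quaternaryC1ω1 = hasMinWeight-systematic A 4 (lookup (i4 ∷ o4 ∷ o4 ∷ []) , zero , (λ ()) , refl)
  (from-yes (lowerBound? (elements q4) (elements-complete q4) A 4))
  where
  open Codes GF4 (fieldLaws q4)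
  A : Matrix 3
  A = Aμ GF4 i4 (i4 ∷ ω ∷ i4 ∷ [])

lemma4p1 :
    -- (i)  C((0,…,0)) over F_q, length n = 2m, m ≥ 1 : minimum weight 1
    (∀ (q : Q) (m : ℕ) → 1 ≤ m → HasMinWeight (𝔽 q) (DCgen (𝔽 q) (r0000 (𝔽 q) m)) 1)
    -- (ii) C((1,0,…,0)), m ≥ 1 : minimum weight 2
    × (∀ (q : Q) (m : ℕ) → 1 ≤ m → HasMinWeight (𝔽 q) (DCgen (𝔽 q) (r1000 (𝔽 q) m)) 2)
    -- (iii) C((1,1,0,…,0)), n ≥ 6 i.e. m ≥ 3 : minimum weight 3
    × (∀ (q : Q) (m : ℕ) → 3 ≤ m → HasMinWeight (𝔽 q) (DCgen (𝔽 q) (r1100 (𝔽 q) m)) 3)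
    --       ternary N((1,1)) and quaternary C((1,ω)) : minimum weight 3
    × HasMinWeight GF3 (DNgen GF3 (i3 ∷ i3 ∷ [])) 3
    × HasMinWeight GF4 (DCgen GF4 (i4 ∷ ω ∷ [])) 3
    -- (iv) C((0,1,…,1)), n ≥ 8 i.e. m ≥ 4 : minimum weight 4
    × (∀ (q : Q) (m : ℕ) → 4 ≤ m → HasMinWeight (𝔽 q) (DCgen (𝔽 q) (r0111 (𝔽 q) m)) 4)
    --       quaternary C((1,ω,1)) : minimum weight 4
    × HasMinWeight GF4 (DCgen GF4 (i4 ∷ ω ∷ i4 ∷ [])) 4
lemma4p1 =
    (λ q → Codes.minWeight-r0000 (𝔽 q) (fieldLaws q))
  , (λ q → Codes.minWeight-r1000 (𝔽 q) (fieldLaws q))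
  , (λ q → Codes.minWeight-r1100 (𝔽 q) (fieldLaws q))
  , minWeight-ternaryN11
  , minWeight-quaternaryC1ω
  , (λ q → Codes.minWeight-r0111 (𝔽 q) (fieldLaws q))
  , minWeight-quaternaryC1ω1
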